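{- Let each of $\mathcal{C}_1,\dots,\mathcal{C}_n,\mathcal{D}$ be a category $\mathcal{R}(\sigma)$ or $\mathcal{R}_*(\sigma)$, $\mathbb{C}_i$ comonads on $\mathcal{C}_i$, $\mathbb{D}$ a comonad on $\mathcal{D}$ preserving embeddings, $H\colon\prod_i\mathcal{C}_i\to\mathcal{D}$ a functor, $\kappa$ a Kleisli law of type $\mathbb{D}\circ H\Rightarrow H\circ\prod_i\mathbb{C}_i$, and $\hat H$ the lifting defined below. Then for coalgebras $(A,\alpha)\in\mathrm{EM}(\mathbb{D})$ and $(B_i,\beta_i)\in\mathrm{EM}(\mathbb{C}_i)$, coalgebra morphisms $f\colon(A,\alpha)\to\hat H((B_1,\beta_1),\dots,(B_n,\beta_n))$ are in one-to-one correspondence $f\mapsto f^\#$ with morphisms $f^\#\colon A\to H(B_1,\dots,B_n)$ in $\mathcal{D}$ satisfying $H(\beta_1,\dots,\beta_n)\circ f^\#=\kappa_{\vec B}\circ\mathbb{D}(f^\#)\circ\alpha$. Moreover, for any $\mathbb{D}$-coalgebra morphism $h\colon(A',\alpha')\to(A,\alpha)$ and $\mathbb{C}_i$-coalgebra morphisms $g_i\colon(B_i,\beta_i)\to(B'_i,\beta'_i)$, $(\hat H(g_1,\dots,g_n)\circ f\circ h)^\#=H(g_1,\dots,g_n)\circ f^\#\circ h$.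
   Context: Embeddings: injective homomorphisms of (pointed) $\sigma$-structures reflecting relations. A Kleisli law $\kappa$ of type $\mathbb{D}\circ H\Rightarrow H\circ\prod_i\mathbb{C}_i$ is a natural transformation $\mathbb{D}H(\vec A)\to H(\vec{\mathbb{C}_iA_i})$ with $H(\vec\varepsilon)\circ\kappa=\varepsilon_H$ and $\kappa_{\vec{\mathbb{C}A}}\circ\mathbb{D}(\kappa)\circ\delta_H=H(\vec\delta)\circ\kappa$. $\mathrm{EM}(\mathbb{C})$ denotes the category of Eilenberg–Moore coalgebras of $\mathbb{C}$ and $F^{\mathbb{D}}(X)=(\mathbb{D}X,\delta_X)$ the cofree coalgebra. Since $\mathbb{D}$ preserves embeddings, $\mathrm{EM}(\mathbb{D})$ has equalisers, and $\hat H((A_1,\alpha_1),\dots,(A_n,\alpha_n))$ is defined as the domain of the equaliser $\iota$ in $\mathrm{EM}(\mathbb{D})$ of the two coalgebra morphisms $\mathbb{D}(\kappa_{\vec A})\circ\delta_{H(\vec A)}$ and $\mathbb{D}(H(\alpha_1,\dots,\alpha_n))$ from $F^{\mathbb{D}}(H(\vec A))$ to $F^{\mathbb{D}}(H(\mathbb{C}_1A_1,\dots,\mathbb{C}_nA_n))$; on morphisms $\hat H(\vec f)$ is induced by the universal property of equalisers from $\mathbb{D}(H(\vec f))\circ\iota$. -}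

module Defs where

open import Data.Nat using (ℕ)
open import Data.Fin using (Fin)
open import Data.Bool using (Bool; true; false)
open import Data.Unit using (⊤; tt)
open import Data.Product using (Σ; _×_; _,_)
open import Relation.Binary.PropositionalEquality using (_≡_; refl; sym; trans; cong)
open import Function using () renaming (_∘_ to _∘ᶠ_)

record Signature : Set₁ where
  field
    Sym : Set
    ar  : Sym → ℕ
open Signature public

Point : Bool → Set → Set
Point false X = ⊤
Point true  X = X

PtPres : (b : Bool) {X Y : Set} → (X → Y) → Point b X → Point b Y → Set
PtPres false f p q = ⊤
PtPres true  f p q = f p ≡ q

-- A category R(σ) (pointed = false) or R_*(σ) (pointed = true)
record StrCat : Set₁ where
  constructor strCat
  field
    sig     : Signature
    pointed : Bool
open StrCat public

record Obj (C : StrCat) : Set₁ where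
  field
    Carrier : Set
    rel     : (R : Sym (sig C)) → (Fin (ar (sig C) R) → Carrier) → Set
    pt      : Point (pointed C) Carrier
open Obj public

record Hom (C : StrCat) (A B : Obj C) : Set where
  field
    fun  : Carrier A → Carrier B
    pres : ∀ R (t : Fin (ar (sig C) R) → Carrier A) → rel A R t → rel B R (fun ∘ᶠ t)
    ptp  : PtPres (pointed C) fun (pt A) (pt B)
open Hom public

_≈_ : ∀ {C} {A B : Obj C} → Hom C A B → Hom C A B → Set
f ≈ g = ∀ x → fun f x ≡ fun g x
infix 4 _≈_

ptId : ∀ b {X : Set} (p : Point b X) → PtPres b (λ x → x) p p
ptId false p = tt
ptId true  p = refl

ptComp : ∀ b {X Y Z : Set} (f : X → Y) (g : Y → Z) (p : Point b X) (q : Point b Y) (r : Point b Z)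
       → PtPres b f p q → PtPres b g q r → PtPres b (g ∘ᶠ f) p r
ptComp false f g p q r _ _ = tt
ptComp true  f g p q r e₁ e₂ = trans (cong g e₁) e₂

id : ∀ {C} {A : Obj C} → Hom C A A
id {C} {A} = record { fun = λ x → x ; pres = λ R t r → r ; ptp = ptId (pointed C) (pt A) }

_∘_ : ∀ {C} {A B E : Obj C} → Hom C B E → Hom C A B → Hom C A E
_∘_ {C} {A} {B} {E} g f = record
  { fun  = fun g ∘ᶠ fun f
  ; pres = λ R t r → pres g R (fun f ∘ᶠ t) (pres f R t r)
  ; ptp  = ptComp (pointed C) (fun f) (fun g) (pt A) (pt B) (pt E) (ptp f) (ptp g) }
infixr 9 _∘_

record IsEmbedding {C} {A B : Obj C} (f : Hom C A B) : Set where
  field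
    injective : ∀ x y → fun f x ≡ fun f y → x ≡ y
    reflects  : ∀ R (t : Fin (ar (sig C) R) → Carrier A) → rel B R (fun f ∘ᶠ t) → rel A R t

record Comonad (C : StrCat) : Set₁ where
  field
    F₀ : Obj C → Obj C
    F₁ : ∀ {A B} → Hom C A B → Hom C (F₀ A) (F₀ B)
    identity     : ∀ {A} → F₁ (id {C} {A}) ≈ id
    homomorphism : ∀ {A B E} {f : Hom C A B} {g : Hom C B E} → F₁ (g ∘ f) ≈ F₁ g ∘ F₁ f
    F-resp-≈     : ∀ {A B} {f g : Hom C A B} → f ≈ g → F₁ f ≈ F₁ g
    ε : ∀ A → Hom C (F₀ A) A
    δ : ∀ A → Hom C (F₀ A) (F₀ (F₀ A))
    ε-natural : ∀ {A B} (f : Hom C A B) → f ∘ ε A ≈ ε B ∘ F₁ f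
    δ-natural : ∀ {A B} (f : Hom C A B) → F₁ (F₁ f) ∘ δ A ≈ δ B ∘ F₁ f
    counitˡ : ∀ {A} → ε (F₀ A) ∘ δ A ≈ id
    counitʳ : ∀ {A} → F₁ (ε A) ∘ δ A ≈ id
    coassoc : ∀ {A} → δ (F₀ A) ∘ δ A ≈ F₁ (δ A) ∘ δ A
open Comonad public

PreservesEmbeddings : ∀ {C} → Comonad C → Set₁
PreservesEmbeddings {C} K = ∀ {A B : Obj C} (f : Hom C A B) → IsEmbedding f → IsEmbedding (F₁ K f)

ObjΠ : ∀ {n} → (Fin n → StrCat) → Set₁
ObjΠ {n} C = (i : Fin n) → Obj (C i)

HomΠ : ∀ {n} (C : Fin n → StrCat) → ObjΠ C → ObjΠ C → Set
HomΠ {n} C A B = (i : Fin n) → Hom (C i) (A i) (B i)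

record FunctorΠ {n} (C : Fin n → StrCat) (D : StrCat) : Set₁ where
  field
    F₀ : ObjΠ C → Obj D
    F₁ : ∀ {A B} → HomΠ C A B → Hom D (F₀ A) (F₀ B)
    identity     : ∀ {A} → F₁ {A} (λ i → id) ≈ id
    homomorphism : ∀ {A B E} {f : HomΠ C A B} {g : HomΠ C B E}
                   → F₁ (λ i → g i ∘ f i) ≈ F₁ g ∘ F₁ f
    F-resp-≈     : ∀ {A B} {f g : HomΠ C A B} → (∀ i → f i ≈ g i) → F₁ f ≈ F₁ g
open FunctorΠ public

ΠF₀ : ∀ {n} {C : Fin n → StrCat} → ((i : Fin n) → Comonad (C i)) → ObjΠ C → ObjΠ C
ΠF₀ Cs A i = F₀ (Cs i) (A i)

record KleisliLaw {n} {C : Fin n → StrCat} {D : StrCat}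
                  (Cs : (i : Fin n) → Comonad (C i)) (Dm : Comonad D)
                  (H : FunctorΠ C D) : Set₁ where
  field
    κ : ∀ A → Hom D (F₀ Dm (F₀ H A)) (F₀ H (ΠF₀ Cs A))
    natural : ∀ {A B} (f : HomΠ C A B)
              → F₁ H (λ i → F₁ (Cs i) (f i)) ∘ κ A ≈ κ B ∘ F₁ Dm (F₁ H f)
    law-ε : ∀ A → F₁ H (λ i → ε (Cs i) (A i)) ∘ κ A ≈ ε Dm (F₀ H A)
    law-δ : ∀ A → κ (ΠF₀ Cs A) ∘ F₁ Dm (κ A) ∘ δ Dm (F₀ H A)
                  ≈ F₁ H (λ i → δ (Cs i) (A i)) ∘ κ A
open KleisliLaw public

record Coalg {C} (K : Comonad C) : Set₁ where
  field
    ob  : Obj C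
    str : Hom C ob (F₀ K ob)
    str-counit : ε K ob ∘ str ≈ id
    str-coassoc : F₁ K str ∘ str ≈ δ K ob ∘ str
open Coalg public

record CoalgHom {C} {K : Comonad C} (X Y : Coalg K) : Set where
  field
    hom  : Hom C (ob X) (ob Y)
    comm : str Y ∘ hom ≈ F₁ K hom ∘ str X
open CoalgHom public

Cofree : ∀ {C} (K : Comonad C) → Obj C → Coalg K
Cofree K X = record
  { ob = F₀ K X ; str = δ K X
  ; str-counit = counitˡ K
  ; str-coassoc = λ x → sym (coassoc K x) }

record Equaliser {C} {K : Comonad C} (X Y : Coalg K) (p q : Hom C (ob X) (ob Y)) : Set₁ where
  field
    obj : Coalg K
    arr : CoalgHom obj X
    equality : p ∘ hom arr ≈ q ∘ hom arr
    factor : ∀ {Z : Coalg K} (h : CoalgHom Z X) → p ∘ hom h ≈ q ∘ hom h → CoalgHom Z obj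
    factor-comm : ∀ {Z : Coalg K} (h : CoalgHom Z X) (e : p ∘ hom h ≈ q ∘ hom h)
                  → hom arr ∘ hom (factor h e) ≈ hom h
    unique : ∀ {Z : Coalg K} (h : CoalgHom Z X) (e : p ∘ hom h ≈ q ∘ hom h) (k : CoalgHom Z obj)
             → hom arr ∘ hom k ≈ hom h → hom k ≈ hom (factor h e)
open Equaliser public

-- The lifting Ĥ on objects: Ĥ(B⃗) is (the domain of) an equaliser ι in EM(𝔻) of
--   𝔻(κ_B) ∘ δ_{H B}  and  𝔻(H(β₁,…,βₙ)) :  F^𝔻(H B) → F^𝔻(H (ℂ₁B₁,…,ℂₙBₙ))

obs : ∀ {n} {C : Fin n → StrCat} {Cs : (i : Fin n) → Comonad (C i)}
      → ((i : Fin n) → Coalg (Cs i)) → ObjΠ C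
obs B i = ob (B i)

LiftingData : ∀ {n} {C : Fin n → StrCat} {D : StrCat}
              (Cs : (i : Fin n) → Comonad (C i)) (Dm : Comonad D)
              (H : FunctorΠ C D) → KleisliLaw Cs Dm H → Set₁
LiftingData {n} Cs Dm H kl =
  (B : (i : Fin n) → Coalg (Cs i)) →
  Equaliser (Cofree Dm (F₀ H (obs B))) (Cofree Dm (F₀ H (ΠF₀ Cs (obs B))))
            (F₁ Dm (κ kl (obs B)) ∘ δ Dm (F₀ H (obs B)))
            (F₁ Dm (F₁ H (λ i → str (B i))))

sharp : ∀ {n} {C : Fin n → StrCat} {D : StrCat}
        {Cs : (i : Fin n) → Comonad (C i)} (Dm : Comonad D)
        (H : FunctorΠ C D) (kl : KleisliLaw Cs Dm H)
        (Ĥ : LiftingData Cs Dm H kl) (B : (i : Fin n) → Coalg (Cs i)) {A : Obj D}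
        → Hom D A (ob (obj (Ĥ B))) → Hom D A (F₀ H (obs B))
sharp Dm H kl Ĥ B u = ε Dm (F₀ H (obs B)) ∘ hom (arr (Ĥ B)) ∘ u

module Submission where

open import Defs
open import Data.Fin using (Fin)
open import Data.Product using (Σ; _×_; _,_)
open import Relation.Binary.PropositionalEquality using (refl; sym; trans; cong; module ≡-Reasoning)

-- A coalgebra morphism m into a cofree coalgebra F^𝔻(X) is determined by ε ∘ m,
-- so ι ∘ f is recovered from f^#; and the equaliser condition defining Ĥ, read through ε,
-- is exactly the compatibility H(β⃗) ∘ f^# = κ ∘ 𝔻(f^#) ∘ α. Existence comes from
-- the cofree extension 𝔻(k) ∘ α of k, uniqueness from ι being monic.

_∘ᶜ_ : ∀ {C} {K : Comonad C} {X Y Z : Coalg K} → CoalgHom Y Z → CoalgHom X Y → CoalgHom X Z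
_∘ᶜ_ {K = K} {X} {Y} {Z} g f = record { hom = hom g ∘ hom f ; comm = λ x → begin
  fun (str Z) (fun (hom g) (fun (hom f) x))         ≡⟨ comm g (fun (hom f) x) ⟩
  fun (F₁ K (hom g)) (fun (str Y) (fun (hom f) x))  ≡⟨ cong (fun (F₁ K (hom g))) (comm f x) ⟩
  fun (F₁ K (hom g)) (fun (F₁ K (hom f)) (fun (str X) x)) ≡⟨ sym (homomorphism K (fun (str X) x)) ⟩
  fun (F₁ K (hom g ∘ hom f)) (fun (str X) x)        ∎ }
  where open ≡-Reasoning

equaliser-mono : ∀ {C} {K : Comonad C} {X Y : Coalg K} {p q : Hom C (ob X) (ob Y)}
                 (E : Equaliser X Y p q) {Z : Coalg K} (f g : CoalgHom Z (obj E))
                 → hom (arr E) ∘ hom f ≈ hom (arr E) ∘ hom g → hom f ≈ hom g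
equaliser-mono {X = X} {p = p} {q} E {Z} f g ιf≈ιg x =
  trans (unique E ιf p∘ιf≈q∘ιf f (λ _ → refl) x)
        (sym (unique E ιf p∘ιf≈q∘ιf g (λ y → sym (ιf≈ιg y)) x))
  where
  ιf : CoalgHom Z X
  ιf = arr E ∘ᶜ f
  p∘ιf≈q∘ιf : p ∘ hom ιf ≈ q ∘ hom ιf
  p∘ιf≈q∘ιf = λ y → equality E (fun (hom f) y)

module _ {C : StrCat} (K : Comonad C) where
  open ≡-Reasoning

  cofree-hom-determined : ∀ {A : Coalg K} {X} (m : CoalgHom A (Cofree K X))
                          → F₁ K (ε K X ∘ hom m) ∘ str A ≈ hom m
  cofree-hom-determined {A} {X} m x = begin
    fun (F₁ K (ε K X ∘ hom m)) (fun (str A) x)               ≡⟨ homomorphism K (fun (str A) x) ⟩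
    fun (F₁ K (ε K X)) (fun (F₁ K (hom m)) (fun (str A) x))  ≡⟨ cong (fun (F₁ K (ε K X))) (sym (comm m x)) ⟩
    fun (F₁ K (ε K X)) (fun (δ K X) (fun (hom m) x))         ≡⟨ counitʳ K (fun (hom m) x) ⟩
    fun (hom m) x                                            ∎

  cofree-extension : ∀ {A : Coalg K} {X} → Hom C (ob A) X → CoalgHom A (Cofree K X)
  cofree-extension {A} {X} k = record { hom = F₁ K k ∘ str A ; comm = λ x → begin
    fun (δ K X) (fun (F₁ K k) (fun (str A) x))               ≡⟨ sym (δ-natural K k (fun (str A) x)) ⟩
    fun (F₁ K (F₁ K k)) (fun (δ K (ob A)) (fun (str A) x))   ≡⟨ cong (fun (F₁ K (F₁ K k))) (sym (str-coassoc A x)) ⟩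
    fun (F₁ K (F₁ K k)) (fun (F₁ K (str A)) (fun (str A) x)) ≡⟨ sym (homomorphism K (fun (str A) x)) ⟩
    fun (F₁ K (F₁ K k ∘ str A)) (fun (str A) x)              ∎ }

  counit-cofree-extension : ∀ {A : Coalg K} {X} (k : Hom C (ob A) X)
                            → ε K X ∘ hom (cofree-extension {A} k) ≈ k
  counit-cofree-extension {A} {X} k x = begin
    fun (ε K X) (fun (F₁ K k) (fun (str A) x))  ≡⟨ sym (ε-natural K k (fun (str A) x)) ⟩
    fun k (fun (ε K (ob A)) (fun (str A) x))    ≡⟨ cong (fun k) (str-counit A x) ⟩
    fun k x                                     ∎

  module _ {A : Coalg K} {X Y} (m : CoalgHom A (Cofree K X))
           (u : Hom C (F₀ K X) Y) (v : Hom C X Y) where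

    counit-of-equalised : (F₁ K u ∘ δ K X) ∘ hom m ≈ F₁ K v ∘ hom m
                          → u ∘ hom m ≈ v ∘ ε K X ∘ hom m
    counit-of-equalised eq x = begin
      fun u (fun (hom m) x)                                   ≡⟨ cong (fun u) (sym (counitˡ K (fun (hom m) x))) ⟩
      fun u (fun (ε K (F₀ K X)) (fun (δ K X) (fun (hom m) x))) ≡⟨ ε-natural K u (fun (δ K X) (fun (hom m) x)) ⟩
      fun (ε K Y) (fun (F₁ K u) (fun (δ K X) (fun (hom m) x))) ≡⟨ cong (fun (ε K Y)) (eq x) ⟩
      fun (ε K Y) (fun (F₁ K v) (fun (hom m) x))              ≡⟨ sym (ε-natural K v (fun (hom m) x)) ⟩
      fun v (fun (ε K X) (fun (hom m) x))                     ∎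

    equalised-by-counit : u ∘ hom m ≈ v ∘ ε K X ∘ hom m
                          → (F₁ K u ∘ δ K X) ∘ hom m ≈ F₁ K v ∘ hom m
    equalised-by-counit eq x = begin
      fun (F₁ K u) (fun (δ K X) (fun (hom m) x))              ≡⟨ cong (fun (F₁ K u)) (comm m x) ⟩
      fun (F₁ K u) (fun (F₁ K (hom m)) (fun (str A) x))       ≡⟨ sym (homomorphism K (fun (str A) x)) ⟩
      fun (F₁ K (u ∘ hom m)) (fun (str A) x)                  ≡⟨ F-resp-≈ K eq (fun (str A) x) ⟩
      fun (F₁ K (v ∘ ε K X ∘ hom m)) (fun (str A) x)          ≡⟨ homomorphism K (fun (str A) x) ⟩
      fun (F₁ K v) (fun (F₁ K (ε K X ∘ hom m)) (fun (str A) x)) ≡⟨ cong (fun (F₁ K v)) (cofree-hom-determined m x) ⟩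
      fun (F₁ K v) (fun (hom m) x)                            ∎

module _ {n} {C : Fin n → StrCat} {D : StrCat}
         {Cs : (i : Fin n) → Comonad (C i)} {Dm : Comonad D}
         (H : FunctorΠ C D) (kl : KleisliLaw Cs Dm H) (Ĥ : LiftingData Cs Dm H kl) where
  open ≡-Reasoning

  module _ {A : Coalg Dm} (B : (i : Fin n) → Coalg (Cs i)) where
    private
      HB = F₀ H (obs B)
      Hβ = F₁ H (λ i → str (B i))
      κB = κ kl (obs B)
      ι = hom (arr (Ĥ B))
      _♯ = sharp Dm H kl Ĥ B

    sharp-compatible : (f : CoalgHom A (obj (Ĥ B))) → Hβ ∘ hom f ♯ ≈ κB ∘ F₁ Dm (hom f ♯) ∘ str A
    sharp-compatible f x = begin
      fun Hβ (fun (ε Dm HB) (fun ι (fun (hom f) x)))  ≡⟨ sym (counit-of-equalised Dm ιf κB Hβ ι-equalises x) ⟩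
      fun κB (fun ι (fun (hom f) x))                  ≡⟨ cong (fun κB) (sym (cofree-hom-determined Dm ιf x)) ⟩
      fun κB (fun (F₁ Dm (hom f ♯)) (fun (str A) x))  ∎
      where
      ιf : CoalgHom A (Cofree Dm HB)
      ιf = arr (Ĥ B) ∘ᶜ f
      ι-equalises : (F₁ Dm κB ∘ δ Dm HB) ∘ hom ιf ≈ F₁ Dm Hβ ∘ hom ιf
      ι-equalises = λ y → equality (Ĥ B) (fun (hom f) y)

    sharp-injective : (f g : CoalgHom A (obj (Ĥ B))) → hom f ♯ ≈ hom g ♯ → hom f ≈ hom g
    sharp-injective f g f♯≈g♯ = equaliser-mono (Ĥ B) f g λ x → begin
      fun ι (fun (hom f) x)                  ≡⟨ sym (cofree-hom-determined Dm (arr (Ĥ B) ∘ᶜ f) x) ⟩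
      fun (F₁ Dm (hom f ♯)) (fun (str A) x)  ≡⟨ F-resp-≈ Dm f♯≈g♯ (fun (str A) x) ⟩
      fun (F₁ Dm (hom g ♯)) (fun (str A) x)  ≡⟨ cofree-hom-determined Dm (arr (Ĥ B) ∘ᶜ g) x ⟩
      fun ι (fun (hom g) x)                  ∎

    sharp-surjective : (k : Hom D (ob A) HB) → Hβ ∘ k ≈ κB ∘ F₁ Dm k ∘ str A
                       → Σ (CoalgHom A (obj (Ĥ B))) (λ f → hom f ♯ ≈ k)
    sharp-surjective k k-compatible = f , λ x → begin
      fun (ε Dm HB) (fun ι (fun (hom f) x))  ≡⟨ cong (fun (ε Dm HB)) (factor-comm (Ĥ B) m m-equalises x) ⟩
      fun (ε Dm HB) (fun (hom m) x)          ≡⟨ counit-cofree-extension Dm {A} k x ⟩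
      fun k x                                ∎
      where
      m : CoalgHom A (Cofree Dm HB)
      m = cofree-extension Dm k
      m-equalises : (F₁ Dm κB ∘ δ Dm HB) ∘ hom m ≈ F₁ Dm Hβ ∘ hom m
      m-equalises = equalised-by-counit Dm m κB Hβ λ x → begin
        fun κB (fun (hom m) x)                    ≡⟨ sym (k-compatible x) ⟩
        fun Hβ (fun k x)                          ≡⟨ cong (fun Hβ) (sym (counit-cofree-extension Dm {A} k x)) ⟩
        fun Hβ (fun (ε Dm HB) (fun (hom m) x))    ∎
      f : CoalgHom A (obj (Ĥ B))
      f = factor (Ĥ B) m m-equalises

  sharp-natural : ∀ {A A' : Obj D} {B B' : (i : Fin n) → Coalg (Cs i)}
                  (g : (i : Fin n) → CoalgHom (B i) (B' i)) (Ĥg : Hom D (ob (obj (Ĥ B))) (ob (obj (Ĥ B'))))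
                  → hom (arr (Ĥ B')) ∘ Ĥg ≈ F₁ Dm (F₁ H (λ i → hom (g i))) ∘ hom (arr (Ĥ B))
                  → (f : Hom D A (ob (obj (Ĥ B)))) (h : Hom D A' A)
                  → sharp Dm H kl Ĥ B' (Ĥg ∘ f ∘ h) ≈ F₁ H (λ i → hom (g i)) ∘ sharp Dm H kl Ĥ B f ∘ h
  sharp-natural {B' = B'} g Ĥg Ĥg-lifts f h x =
    trans (cong (fun (ε Dm (F₀ H (obs B')))) (Ĥg-lifts (fun f (fun h x))))
          (sym (ε-natural Dm (F₁ H (λ i → hom (g i))) _))

-- Preservation of embeddings is what makes the equalisers Ĥ(B⃗) exist in EM(𝔻);
-- here they are given as data.
proposition1 : ∀ {n} (C : Fin n → StrCat) (D : StrCat)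
                 (Cs : (i : Fin n) → Comonad (C i)) (Dm : Comonad D)
                 → PreservesEmbeddings Dm
                 → (H : FunctorΠ C D) (kl : KleisliLaw Cs Dm H)
                 → (Ĥ : LiftingData Cs Dm H kl)
                 → ((A : Coalg Dm) (B : (i : Fin n) → Coalg (Cs i)) →
                      ((f : CoalgHom A (obj (Ĥ B))) →
                         F₁ H (λ i → str (B i)) ∘ sharp Dm H kl Ĥ B (hom f)
                           ≈ κ kl (obs B) ∘ F₁ Dm (sharp Dm H kl Ĥ B (hom f)) ∘ str A)
                      × ((f g : CoalgHom A (obj (Ĥ B))) →
                           sharp Dm H kl Ĥ B (hom f) ≈ sharp Dm H kl Ĥ B (hom g) → hom f ≈ hom g)
                      × ((k : Hom D (ob A) (F₀ H (obs B))) →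
                           F₁ H (λ i → str (B i)) ∘ k ≈ κ kl (obs B) ∘ F₁ Dm k ∘ str A →
                           Σ (CoalgHom A (obj (Ĥ B))) (λ f → sharp Dm H kl Ĥ B (hom f) ≈ k)))
                 × ((A A' : Coalg Dm) (h : CoalgHom A' A)
                    (B B' : (i : Fin n) → Coalg (Cs i)) (g : (i : Fin n) → CoalgHom (B i) (B' i))
                    (Ĥg : CoalgHom (obj (Ĥ B)) (obj (Ĥ B')))
                    → hom (arr (Ĥ B')) ∘ hom Ĥg ≈ F₁ Dm (F₁ H (λ i → hom (g i))) ∘ hom (arr (Ĥ B))
                    → (f : CoalgHom A (obj (Ĥ B)))
                    → sharp Dm H kl Ĥ B' (hom Ĥg ∘ hom f ∘ hom h)
                        ≈ F₁ H (λ i → hom (g i)) ∘ sharp Dm H kl Ĥ B (hom f) ∘ hom h)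
proposition1 C D Cs Dm _ H kl Ĥ =
  (λ A B → sharp-compatible H kl Ĥ B , sharp-injective H kl Ĥ B , sharp-surjective H kl Ĥ B)
  , λ A A' h B B' g Ĥg Ĥg-lifts f → sharp-natural H kl Ĥ g (hom Ĥg) Ĥg-lifts (hom f) (hom h)
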